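{- A lattice $L$ is distributive if and only if every comaximal pair of $L$ is of the form $(P,L\setminus P)$ for some prime ideal $P$ of $L$; equivalently, iff the map $b_L:spec(L)\to\mathfrak{M}(L)$, $P\mapsto (P,L\setminus P)$, is bijective.
   Context: Ideals and filters are nonempty; $spec(L)$ is the set of prime ideals of $L$ (ideals $P$ with $x\wedge y\in P\Rightarrow x\in P$ or $y\in P$; for such $P$, $(P,L\setminus P)$ is a comaximal pair). A comaximal pair of $L$ is $(I,F)$, $I$ an ideal, $F$ a filter, $I\cap F=\emptyset$, such that every ideal $J\supsetneq I$ meets $F$ and every filter $K\supsetneq F$ meets $I$; $\mathfrak{M}(L)$ is the set of comaximal pairs. -}

module Defs where

open import Level using (Level; _⊔_; suc)
open import Data.Product using (Σ; _×_; ∃; ∃-syntax; _,_)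
open import Data.Sum using (_⊎_)
open import Relation.Nullary using (¬_)
open import Relation.Binary using (Rel; IsPreorder)
open import Relation.Unary using (Pred; _∈_; _∉_; _⊆_)
open import Algebra.Lattice.Bundles using (Lattice)
open import Algebra.Lattice.Structures using (IsDistributiveLattice)

Zorn : (a r : Level) → Set (suc (a ⊔ r))
Zorn a r =
  (A : Set a) (_≤_ : Rel A r) → IsPreorder _≡_ _≤_ → A →
  ((C : Pred A a) → (∀ {x y} → x ∈ C → y ∈ C → (x ≤ y) ⊎ (y ≤ x)) →
     ∃[ u ] (∀ {x} → x ∈ C → x ≤ u)) →
  ∃[ m ] (∀ x → m ≤ x → x ≤ m)
  where open import Relation.Binary.PropositionalEquality using (_≡_)

module LatticeNotions {c ℓ : Level} (L : Lattice c ℓ) where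
  open Lattice L

  Subset : Set (suc (c ⊔ ℓ))
  Subset = Pred Carrier (c ⊔ ℓ)

  _≤_ : Rel Carrier ℓ
  x ≤ y = (x ∧ y) ≈ x

  _≐_ : Subset → Subset → Set (c ⊔ ℓ)
  A ≐ B = (A ⊆ B) × (B ⊆ A)

  ∁ : Subset → Subset
  ∁ A = λ x → ¬ A x

  _⊋_ : Subset → Subset → Set (c ⊔ ℓ)
  A ⊋ B = (B ⊆ A) × ∃[ x ] (x ∈ A × x ∉ B)

  Meets : Subset → Subset → Set (c ⊔ ℓ)
  Meets A B = ∃[ x ] (x ∈ A × x ∈ B)

  record IsIdeal (I : Subset) : Set (c ⊔ ℓ) where
    field
      nonempty  : ∃[ x ] (x ∈ I)
      down      : ∀ {x y} → x ≤ y → y ∈ I → x ∈ I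
      ∨-closed  : ∀ {x y} → x ∈ I → y ∈ I → (x ∨ y) ∈ I

  record IsFilter (F : Subset) : Set (c ⊔ ℓ) where
    field
      nonempty  : ∃[ x ] (x ∈ F)
      up        : ∀ {x y} → x ≤ y → x ∈ F → y ∈ F
      ∧-closed  : ∀ {x y} → x ∈ F → y ∈ F → (x ∧ y) ∈ F

  record IsPrimeIdeal (P : Subset) : Set (c ⊔ ℓ) where
    field
      isIdeal : IsIdeal P
      proper  : ∃[ x ] (x ∉ P)
      prime   : ∀ {x y} → (x ∧ y) ∈ P → x ∈ P ⊎ y ∈ P

  record IsComaximalPair (I F : Subset) : Set (suc (c ⊔ ℓ)) where
    field
      isIdeal   : IsIdeal I
      isFilter  : IsFilter F
      disjoint  : ∀ {x} → x ∈ I → x ∉ F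
      maxIdeal  : ∀ (J : Subset) → IsIdeal J → J ⊋ I → Meets J F
      maxFilter : ∀ (K : Subset) → IsFilter K → K ⊋ F → Meets K I

  Spec : Set (suc (c ⊔ ℓ))
  Spec = Σ Subset IsPrimeIdeal

  𝔐 : Set (suc (c ⊔ ℓ))
  𝔐 = Σ (Subset × Subset) (λ { (I , F) → IsComaximalPair I F })

  _≐𝔐_ : 𝔐 → 𝔐 → Set (c ⊔ ℓ)
  ((I , F) , _) ≐𝔐 ((J , G) , _) = (I ≐ J) × (F ≐ G)

  _IsPairOf_ : (Subset × Subset) → Subset → Set (c ⊔ ℓ)
  (I , F) IsPairOf P = (I ≐ P) × (F ≐ ∁ P)

  EveryComaximalPairIsPrime : Set (suc (c ⊔ ℓ))
  EveryComaximalPairIsPrime =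
    ∀ (I F : Subset) → IsComaximalPair I F →
      ∃[ P ] (IsPrimeIdeal P × ((I , F) IsPairOf P))

  -- Since b_L is only defined as a map into 𝔐(L) given that (P, L\P) is
  -- comaximal, we state: b_L is well defined (lands in 𝔐(L)),
  -- injective and surjective, all up to extensional equality of subsets.
  bLIsBijective : Set (suc (c ⊔ ℓ))
  bLIsBijective =
    (∀ (P : Subset) → IsPrimeIdeal P → IsComaximalPair P (∁ P))
    × (∀ (P Q : Subset) → IsPrimeIdeal P → IsPrimeIdeal Q →
         (P , ∁ P) IsPairOf Q → P ≐ Q)
    × (∀ (I F : Subset) → IsComaximalPair I F →
         ∃[ P ] (IsPrimeIdeal P × ((I , F) IsPairOf P)))

  IsDistributive : Set (c ⊔ ℓ)
  IsDistributive = IsDistributiveLattice _≈_ _∨_ _∧_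

{-# OPTIONS --safe #-}
-- In a distributive lattice a comaximal pair (I , F) covers L: were x in
-- neither, maximality would give f ≤ i ∨ x and g ∧ x ≤ j with f, g ∈ F and
-- i, j ∈ I, and distributivity turns this into f ∧ g ≤ i ∨ j, a point of
-- I ∩ F. A covering comaximal pair is (P , L \ P) with P prime, and
-- conversely every such pair is comaximal. For the other direction, Zorn's
-- lemma extends (↓ b , ↑ a) to a comaximal pair whenever a ≰ b; its prime
-- ideal then separates b from a, and a lattice in which prime ideals
-- separate points is distributive.
module Submission where

open import Defs
open import Level using (Level; _⊔_; suc; Lift; lift; lower)
open import Data.Product using (_×_; _,_; proj₁; proj₂; ∃-syntax)
open import Data.Sum using (_⊎_; inj₁; inj₂; [_,_]′)
open import Data.Empty using (⊥; ⊥-elim)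
open import Function using (id; _∘_)
open import Function.Bundles using (_⇔_; mk⇔)
open import Axiom.ExcludedMiddle using (ExcludedMiddle)
open import Algebra.Lattice.Bundles using (Lattice)
open import Algebra.Lattice.Structures using (IsDistributiveLattice)
open import Relation.Nullary using (¬_; Dec; yes; no)
open import Relation.Nullary.Decidable using (True; map′; toWitness; fromWitness; decidable-stable)
open import Relation.Unary using (Pred; _∈_; _∉_; _⊆_)
open import Relation.Binary using (Rel; IsPreorder)
open import Relation.Binary.PropositionalEquality using (_≡_)
import Relation.Binary.PropositionalEquality as ≡
import Algebra.Consequences.Setoid as Consequences
import Algebra.Lattice.Properties.Lattice as LatticeProperties
import Relation.Binary.Lattice as OrderLattice
import Relation.Binary.Lattice.Properties.JoinSemilattice as JoinSemilatticeProperties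
import Relation.Binary.Lattice.Properties.MeetSemilattice as MeetSemilatticeProperties

module _ {c ℓ : Level} (L : Lattice c ℓ) where
  open Lattice L
  open LatticeNotions L
  open import Algebra.Definitions _≈_ using (_DistributesOver_; _DistributesOverˡ_)

  private
    module O = OrderLattice.Lattice (LatticeProperties.∨-∧-orderTheoreticLattice L)
    module J = JoinSemilatticeProperties O.joinSemilattice
    module M = MeetSemilatticeProperties O.meetSemilattice

  ≤-refl : ∀ {x} → x ≤ x
  ≤-refl = sym O.refl

  ≤-reflexive : ∀ {x y} → x ≈ y → x ≤ y
  ≤-reflexive e = sym (O.reflexive e)

  ≤-trans : ∀ {x y z} → x ≤ y → y ≤ z → x ≤ z
  ≤-trans p q = sym (O.trans (sym p) (sym q))

  ≤-antisym : ∀ {x y} → x ≤ y → y ≤ x → x ≈ y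
  ≤-antisym p q = O.antisym (sym p) (sym q)

  x≤x∨y : ∀ {x y} → x ≤ (x ∨ y)
  x≤x∨y = sym (O.x≤x∨y _ _)

  y≤x∨y : ∀ {x y} → y ≤ (x ∨ y)
  y≤x∨y = sym (O.y≤x∨y _ _)

  ∨-least : ∀ {x y z} → x ≤ z → y ≤ z → (x ∨ y) ≤ z
  ∨-least p q = sym (O.∨-least (sym p) (sym q))

  x∧y≤x : ∀ {x y} → (x ∧ y) ≤ x
  x∧y≤x = sym (O.x∧y≤x _ _)

  x∧y≤y : ∀ {x y} → (x ∧ y) ≤ y
  x∧y≤y = sym (O.x∧y≤y _ _)

  ∧-greatest : ∀ {x y z} → z ≤ x → z ≤ y → z ≤ (x ∧ y)
  ∧-greatest p q = sym (O.∧-greatest (sym p) (sym q))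

  ∨-monotonic : ∀ {x x′ y y′} → x ≤ x′ → y ≤ y′ → (x ∨ y) ≤ (x′ ∨ y′)
  ∨-monotonic p q = sym (J.∨-monotonic (sym p) (sym q))

  ∧-monotonic : ∀ {x x′ y y′} → x ≤ x′ → y ≤ y′ → (x ∧ y) ≤ (x′ ∧ y′)
  ∧-monotonic p q = sym (M.∧-monotonic (sym p) (sym q))

  ∧-distribˡ-∨⇒distributive : _∧_ DistributesOverˡ _∨_ → IsDistributive
  ∧-distribˡ-∨⇒distributive ∧-distribˡ-∨ = record
    { isLattice   = isLattice
    ; ∨-distrib-∧ = comm∧distrˡ⇒distr ∧-cong ∨-comm ∨-distribˡ-∧
    ; ∧-distrib-∨ = ∧-distrib-∨
    }
    where
    open Consequences setoid using (comm∧distrˡ⇒distr; distrib∧absorbs⇒distribˡ)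
    ∧-distrib-∨ : _∧_ DistributesOver _∨_
    ∧-distrib-∨ = comm∧distrˡ⇒distr ∨-cong ∧-comm ∧-distribˡ-∨
    ∨-distribˡ-∧ : _∨_ DistributesOverˡ _∧_
    ∨-distribˡ-∧ = distrib∧absorbs⇒distribˡ ∨-cong ∨-assoc ∧-comm
                     ∨-absorbs-∧ ∧-absorbs-∨ ∧-distrib-∨

  distributive-cut : IsDistributive → ∀ {f g i j x} →
    f ≤ (i ∨ x) → (g ∧ x) ≤ j → (f ∧ g) ≤ (i ∨ j)
  distributive-cut dist {f} {g} {i} {j} {x} f≤i∨x g∧x≤j = ≤-trans split bound
    where
    h : Carrier
    h = f ∧ g
    split : h ≤ ((h ∧ i) ∨ (h ∧ x))
    split = ≤-trans (∧-greatest ≤-refl (≤-trans x∧y≤x f≤i∨x))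
                    (≤-reflexive (proj₁ (IsDistributiveLattice.∧-distrib-∨ dist) h i x))
    bound : ((h ∧ i) ∨ (h ∧ x)) ≤ (i ∨ j)
    bound = ∨-monotonic x∧y≤y (≤-trans (∧-monotonic x∧y≤y ≤-refl) g∧x≤j)

  ↓_ : Carrier → Subset
  ↓ b = λ x → Lift c (x ≤ b)

  ↑_ : Carrier → Subset
  ↑ a = λ x → Lift c (a ≤ x)

  ↓-isIdeal : ∀ b → IsIdeal (↓ b)
  ↓-isIdeal b = record
    { nonempty = b , lift ≤-refl
    ; down     = λ x≤y y≤b → lift (≤-trans x≤y (lower y≤b))
    ; ∨-closed = λ x≤b y≤b → lift (∨-least (lower x≤b) (lower y≤b))
    }

  ↑-isFilter : ∀ a → IsFilter (↑ a)
  ↑-isFilter a = record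
    { nonempty = a , lift ≤-refl
    ; up       = λ x≤y a≤x → lift (≤-trans (lower a≤x) x≤y)
    ; ∧-closed = λ a≤x a≤y → lift (∧-greatest (lower a≤x) (lower a≤y))
    }

  _∨ᴵ_ : Subset → Carrier → Subset
  (I ∨ᴵ x) y = ∃[ i ] (i ∈ I × y ≤ (i ∨ x))

  _∧ᶠ_ : Subset → Carrier → Subset
  (F ∧ᶠ x) y = ∃[ g ] (g ∈ F × (g ∧ x) ≤ y)

  module _ {I : Subset} (isIdeal : IsIdeal I) (x : Carrier) where
    open IsIdeal isIdeal

    ∨ᴵ-isIdeal : IsIdeal (I ∨ᴵ x)
    ∨ᴵ-isIdeal = record
      { nonempty = x , proj₁ nonempty , proj₂ nonempty , y≤x∨y
      ; down     = λ { z≤y (i , i∈I , y≤i∨x) → i , i∈I , ≤-trans z≤y y≤i∨x }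
      ; ∨-closed = λ { (i , i∈I , y≤i∨x) (i′ , i′∈I , y′≤i′∨x) →
          (i ∨ i′) , ∨-closed i∈I i′∈I ,
          ∨-least (≤-trans y≤i∨x (∨-monotonic x≤x∨y ≤-refl))
                  (≤-trans y′≤i′∨x (∨-monotonic y≤x∨y ≤-refl)) }
      }

    ∨ᴵ-⊋ : x ∉ I → (I ∨ᴵ x) ⊋ I
    ∨ᴵ-⊋ x∉I = (λ {y} y∈I → y , y∈I , x≤x∨y)
             , x , (proj₁ nonempty , proj₂ nonempty , y≤x∨y) , x∉I

  module _ {F : Subset} (isFilter : IsFilter F) (x : Carrier) where
    open IsFilter isFilter

    ∧ᶠ-isFilter : IsFilter (F ∧ᶠ x)
    ∧ᶠ-isFilter = record
      { nonempty = x , proj₁ nonempty , proj₂ nonempty , x∧y≤y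
      ; up       = λ { y≤z (g , g∈F , g∧x≤y) → g , g∈F , ≤-trans g∧x≤y y≤z }
      ; ∧-closed = λ { (g , g∈F , g∧x≤y) (g′ , g′∈F , g′∧x≤y′) →
          (g ∧ g′) , ∧-closed g∈F g′∈F ,
          ∧-greatest (≤-trans (∧-monotonic x∧y≤x ≤-refl) g∧x≤y)
                     (≤-trans (∧-monotonic x∧y≤y ≤-refl) g′∧x≤y′) }
      }

    ∧ᶠ-⊋ : x ∉ F → (F ∧ᶠ x) ⊋ F
    ∧ᶠ-⊋ x∉F = (λ {y} y∈F → y , y∈F , x∧y≤x)
             , x , (proj₁ nonempty , proj₂ nonempty , x∧y≤y) , x∉F

  module _ (dist : IsDistributive) {I F : Subset} (cp : IsComaximalPair I F) where
    open IsComaximalPair cp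
    open IsIdeal isIdeal
    open IsFilter isFilter

    distributive⇒comaximalPair-covers : ∀ {x} → x ∉ I → x ∉ F → ⊥
    distributive⇒comaximalPair-covers {x} x∉I x∉F
      with maxIdeal (I ∨ᴵ x) (∨ᴵ-isIdeal isIdeal x) (∨ᴵ-⊋ isIdeal x x∉I)
         | maxFilter (F ∧ᶠ x) (∧ᶠ-isFilter isFilter x) (∧ᶠ-⊋ isFilter x x∉F)
    ... | f , (i , i∈I , f≤i∨x) , f∈F | j , (g , g∈F , g∧x≤j) , j∈I =
      disjoint (down (distributive-cut dist f≤i∨x g∧x≤j) (∨-closed i∈I j∈I))
               (∧-closed f∈F g∈F)

  covering⇒prime : ∀ {I F} → IsIdeal I → IsFilter F → (∀ {x} → x ∈ I → x ∉ F) →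
    (∀ x → x ∈ I ⊎ x ∈ F) → IsPrimeIdeal I × ((I , F) IsPairOf I)
  covering⇒prime {I} {F} isI isF disjoint covers =
    record { isIdeal = isI ; proper = g , disjoint-from-F g∈F ; prime = prime }
    , (id , id) , disjoint-from-F , outside-I
    where
    open IsFilter isF
    g : Carrier
    g = proj₁ nonempty
    g∈F : g ∈ F
    g∈F = proj₂ nonempty
    disjoint-from-F : ∀ {x} → x ∈ F → x ∉ I
    disjoint-from-F x∈F x∈I = disjoint x∈I x∈F
    outside-I : ∁ I ⊆ F
    outside-I {x} x∉I with covers x
    ... | inj₁ x∈I = ⊥-elim (x∉I x∈I)
    ... | inj₂ x∈F = x∈F
    prime : ∀ {x y} → (x ∧ y) ∈ I → x ∈ I ⊎ y ∈ I
    prime {x} {y} x∧y∈I with covers x | covers y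
    ... | inj₁ x∈I | _        = inj₁ x∈I
    ... | inj₂ _   | inj₁ y∈I = inj₂ y∈I
    ... | inj₂ x∈F | inj₂ y∈F = ⊥-elim (disjoint x∧y∈I (∧-closed x∈F y∈F))

  module _ {P : Subset} (isPrime : IsPrimeIdeal P) where
    open IsPrimeIdeal isPrime
    open IsIdeal isIdeal

    primeIdeal-∧-distribˡ-∨ : ∀ x y z → ((x ∧ y) ∨ (x ∧ z)) ∈ P → (x ∧ (y ∨ z)) ∈ P
    primeIdeal-∧-distribˡ-∨ x y z ∈P with prime (down x≤x∨y ∈P) | prime (down y≤x∨y ∈P)
    ... | inj₁ x∈P | _        = down x∧y≤x x∈P
    ... | inj₂ _   | inj₁ x∈P = down x∧y≤x x∈P
    ... | inj₂ y∈P | inj₂ z∈P = down x∧y≤y (∨-closed y∈P z∈P)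

  PrimeIdealsSeparate : Set (suc (c ⊔ ℓ))
  PrimeIdealsSeparate =
    ∀ {a b} → ¬ (a ≤ b) → ∃[ P ] (IsPrimeIdeal P × b ∈ P × a ∉ P)

  module _ (em : ExcludedMiddle (suc (c ⊔ ℓ))) where

    decide : (A : Set (c ⊔ ℓ)) → Dec A
    decide A = map′ lower lift (em {Lift (suc (c ⊔ ℓ)) A})

    -- Unions over chains of extensions quantify over a large type; excluded
    -- middle makes every proposition equivalent to a small one.
    Resized : Set (suc (c ⊔ ℓ)) → Set (c ⊔ ℓ)
    Resized A = Lift (c ⊔ ℓ) (True (em {A}))

    resize : ∀ {A} → A → Resized A
    resize a = lift (fromWitness a)

    unresize : ∀ {A} → Resized A → A
    unresize r = toWitness (lower r)

    prime⇒comaximalPair : ∀ {P} → IsPrimeIdeal P → IsComaximalPair P (∁ P)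
    prime⇒comaximalPair {P} isPrime = record
      { isIdeal   = isIdeal
      ; isFilter  = record
        { nonempty = proper
        ; up       = λ x≤y x∉P y∈P → x∉P (down x≤y y∈P)
        ; ∧-closed = λ x∉P y∉P x∧y∈P → [ x∉P , y∉P ]′ (prime x∧y∈P)
        }
      ; disjoint  = λ x∈P x∉P → x∉P x∈P
      ; maxIdeal  = λ { _ _ (_ , x , x∈J , x∉P) → x , x∈J , x∉P }
      ; maxFilter = λ { _ _ (_ , x , x∈K , x∉∁P) →
          x , x∈K , decidable-stable (decide (x ∈ P)) x∉∁P }
      }
      where
      open IsPrimeIdeal isPrime
      open IsIdeal isIdeal

    distributive⇒everyComaximalPairIsPrime : IsDistributive → EveryComaximalPairIsPrime
    distributive⇒everyComaximalPairIsPrime dist I F cp =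
      I , covering⇒prime isIdeal isFilter disjoint covers
      where
      open IsComaximalPair cp
      covers : ∀ x → x ∈ I ⊎ x ∈ F
      covers x with decide (x ∈ I) | decide (x ∈ F)
      ... | yes x∈I | _       = inj₁ x∈I
      ... | no _    | yes x∈F = inj₂ x∈F
      ... | no x∉I  | no x∉F  = ⊥-elim (distributive⇒comaximalPair-covers dist cp x∉I x∉F)

    ≤-byPrimeIdeals : PrimeIdealsSeparate → ∀ {a b} →
      (∀ {P} → IsPrimeIdeal P → b ∈ P → a ∈ P) → a ≤ b
    ≤-byPrimeIdeals separate {a} {b} b∈⇒a∈ with decide (Lift c (a ≤ b))
    ... | yes a≤b = lower a≤b
    ... | no a≰b with separate (a≰b ∘ lift)
    ...   | P , isPrime , b∈P , a∉P = ⊥-elim (a∉P (b∈⇒a∈ isPrime b∈P))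

    primeIdealsSeparate⇒distributive : PrimeIdealsSeparate → IsDistributive
    primeIdealsSeparate⇒distributive separate =
      ∧-distribˡ-∨⇒distributive λ x y z →
        ≤-antisym (≤-byPrimeIdeals separate (λ isPrime → primeIdeal-∧-distribˡ-∨ isPrime x y z))
                  (∨-least (∧-monotonic ≤-refl x≤x∨y) (∧-monotonic ≤-refl y≤x∨y))

    module _ (zorn : Zorn (suc (c ⊔ ℓ)) (c ⊔ ℓ))
             {I₀ F₀ : Subset} (isIdeal₀ : IsIdeal I₀) (isFilter₀ : IsFilter F₀)
             (disjoint₀ : ∀ {x} → x ∈ I₀ → x ∉ F₀) where

      record Extension : Set (suc (c ⊔ ℓ)) where
        field
          I F      : Subset
          isIdeal  : IsIdeal I
          isFilter : IsFilter F
          disjoint : ∀ {x} → x ∈ I → x ∉ F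
          I₀⊆I     : I₀ ⊆ I
          F₀⊆F     : F₀ ⊆ F

      open Extension

      _⊑_ : Rel Extension (c ⊔ ℓ)
      p ⊑ q = (I p ⊆ I q) × (F p ⊆ F q)

      ⊑-refl : ∀ p → p ⊑ p
      ⊑-refl _ = id , id

      ⊑-isPreorder : IsPreorder _≡_ _⊑_
      ⊑-isPreorder = record
        { isEquivalence = ≡.isEquivalence
        ; reflexive     = λ { {p} ≡.refl → ⊑-refl p }
        ; trans         = λ (I⊆ , F⊆) (I⊆′ , F⊆′) → I⊆′ ∘ I⊆ , F⊆′ ∘ F⊆
        }

      base : Extension
      base = record
        { I = I₀ ; F = F₀ ; isIdeal = isIdeal₀ ; isFilter = isFilter₀
        ; disjoint = disjoint₀ ; I₀⊆I = id ; F₀⊆F = id }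

      base-least : ∀ p → base ⊑ p
      base-least p = I₀⊆I p , F₀⊆F p

      module ChainUnion (C : Pred Extension (suc (c ⊔ ℓ)))
                        (comparable : ∀ {p q} → p ∈ C → q ∈ C → (p ⊑ q) ⊎ (q ⊑ p)) where

        -- base is added so that the union of the empty chain is an extension too
        C⁺ : Pred Extension (suc (c ⊔ ℓ))
        C⁺ p = p ∈ C ⊎ p ≡ base

        upperBound : ∀ {p q} → p ∈ C⁺ → q ∈ C⁺ → ∃[ r ] (r ∈ C⁺ × p ⊑ r × q ⊑ r)
        upperBound {q = q} (inj₂ ≡.refl) q∈ = q , q∈ , base-least q , ⊑-refl q
        upperBound {p = p} p∈ (inj₂ ≡.refl) = p , p∈ , ⊑-refl p , base-least p
        upperBound {p} {q} (inj₁ p∈C) (inj₁ q∈C) with comparable p∈C q∈C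
        ... | inj₁ p⊑q = q , inj₁ q∈C , p⊑q , ⊑-refl q
        ... | inj₂ q⊑p = p , inj₁ p∈C , ⊑-refl p , q⊑p

        InUnion : (Extension → Subset) → Carrier → Set (suc (c ⊔ ℓ))
        InUnion S x = ∃[ p ] (p ∈ C⁺ × x ∈ S p)

        union-down : ∀ {x y} → x ≤ y → InUnion I y → InUnion I x
        union-down x≤y (p , p∈ , y∈) = p , p∈ , IsIdeal.down (isIdeal p) x≤y y∈

        union-up : ∀ {x y} → x ≤ y → InUnion F x → InUnion F y
        union-up x≤y (p , p∈ , x∈) = p , p∈ , IsFilter.up (isFilter p) x≤y x∈

        union-∨-closed : ∀ {x y} → InUnion I x → InUnion I y → InUnion I (x ∨ y)
        union-∨-closed (p , p∈ , x∈) (q , q∈ , y∈) with upperBound p∈ q∈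
        ... | r , r∈ , p⊑r , q⊑r =
          r , r∈ , IsIdeal.∨-closed (isIdeal r) (proj₁ p⊑r x∈) (proj₁ q⊑r y∈)

        union-∧-closed : ∀ {x y} → InUnion F x → InUnion F y → InUnion F (x ∧ y)
        union-∧-closed (p , p∈ , x∈) (q , q∈ , y∈) with upperBound p∈ q∈
        ... | r , r∈ , p⊑r , q⊑r =
          r , r∈ , IsFilter.∧-closed (isFilter r) (proj₂ p⊑r x∈) (proj₂ q⊑r y∈)

        union-disjoint : ∀ {x} → InUnion I x → InUnion F x → ⊥
        union-disjoint (p , p∈ , x∈I) (q , q∈ , x∈F) with upperBound p∈ q∈
        ... | r , _ , p⊑r , q⊑r = disjoint r (proj₁ p⊑r x∈I) (proj₂ q⊑r x∈F)

        union : Extension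
        union = record
          { I        = Resized ∘ InUnion I
          ; F        = Resized ∘ InUnion F
          ; isIdeal  = record
            { nonempty = proj₁ (IsIdeal.nonempty isIdeal₀) , I₀⊆union (proj₂ (IsIdeal.nonempty isIdeal₀))
            ; down     = λ x≤y → resize ∘ union-down x≤y ∘ unresize
            ; ∨-closed = λ x∈ y∈ → resize (union-∨-closed (unresize x∈) (unresize y∈))
            }
          ; isFilter = record
            { nonempty = proj₁ (IsFilter.nonempty isFilter₀) , F₀⊆union (proj₂ (IsFilter.nonempty isFilter₀))
            ; up       = λ x≤y → resize ∘ union-up x≤y ∘ unresize
            ; ∧-closed = λ x∈ y∈ → resize (union-∧-closed (unresize x∈) (unresize y∈))
            }
          ; disjoint = λ x∈I x∈F → union-disjoint (unresize x∈I) (unresize x∈F)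
          ; I₀⊆I     = I₀⊆union
          ; F₀⊆F     = F₀⊆union
          }
          where
          I₀⊆union : I₀ ⊆ Resized ∘ InUnion I
          I₀⊆union x∈I₀ = resize (base , inj₂ ≡.refl , x∈I₀)
          F₀⊆union : F₀ ⊆ Resized ∘ InUnion F
          F₀⊆union x∈F₀ = resize (base , inj₂ ≡.refl , x∈F₀)

        ⊑-union : ∀ {p} → p ∈ C → p ⊑ union
        ⊑-union {p} p∈C = (λ x∈ → resize (p , inj₁ p∈C , x∈))
                        , (λ x∈ → resize (p , inj₁ p∈C , x∈))

      maximal⇒comaximalPair : ∀ {m} → (∀ p → m ⊑ p → p ⊑ m) → IsComaximalPair (I m) (F m)
      maximal⇒comaximalPair {m} maximal = record
        { isIdeal   = isIdeal m
        ; isFilter  = isFilter m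
        ; disjoint  = disjoint m
        ; maxIdeal  = maxIdeal
        ; maxFilter = maxFilter
        }
        where
        maxIdeal : ∀ J → IsIdeal J → J ⊋ I m → Meets J (F m)
        maxIdeal J isJ (I⊆J , x , x∈J , x∉I) =
          decidable-stable (decide _) λ J∩F≡∅ → x∉I (proj₁ (maximal (extension J∩F≡∅) (I⊆J , id)) x∈J)
          where
          extension : ¬ Meets J (F m) → Extension
          extension J∩F≡∅ = record
            { I = J ; F = F m ; isIdeal = isJ ; isFilter = isFilter m
            ; disjoint = λ y∈J y∈F → J∩F≡∅ (_ , y∈J , y∈F)
            ; I₀⊆I = I⊆J ∘ I₀⊆I m ; F₀⊆F = F₀⊆F m }
        maxFilter : ∀ K → IsFilter K → K ⊋ F m → Meets K (I m)
        maxFilter K isK (F⊆K , x , x∈K , x∉F) =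
          decidable-stable (decide _) λ K∩I≡∅ → x∉F (proj₂ (maximal (extension K∩I≡∅) (id , F⊆K)) x∈K)
          where
          extension : ¬ Meets K (I m) → Extension
          extension K∩I≡∅ = record
            { I = I m ; F = K ; isIdeal = isIdeal m ; isFilter = isK
            ; disjoint = λ y∈I y∈K → K∩I≡∅ (_ , y∈K , y∈I)
            ; I₀⊆I = I₀⊆I m ; F₀⊆F = F⊆K ∘ F₀⊆F m }

      chain-bounded : ∀ C → (∀ {p q} → p ∈ C → q ∈ C → (p ⊑ q) ⊎ (q ⊑ p)) →
        ∃[ u ] (∀ {p} → p ∈ C → p ⊑ u)
      chain-bounded C comparable = union , λ {p} → ⊑-union {p}
        where open ChainUnion C comparable

      comaximalExtension : ∃[ I ] ∃[ F ] (IsComaximalPair I F × I₀ ⊆ I × F₀ ⊆ F)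
      comaximalExtension with zorn Extension _⊑_ ⊑-isPreorder base chain-bounded
      ... | m , maximal = I m , F m , maximal⇒comaximalPair {m} maximal , I₀⊆I m , F₀⊆F m

    everyComaximalPairIsPrime⇒primeIdealsSeparate :
      Zorn (suc (c ⊔ ℓ)) (c ⊔ ℓ) → EveryComaximalPairIsPrime → PrimeIdealsSeparate
    everyComaximalPairIsPrime⇒primeIdealsSeparate zorn everyPrime {a} {b} a≰b
      with comaximalExtension zorn (↓-isIdeal b) (↑-isFilter a)
             (λ x≤b a≤x → a≰b (≤-trans (lower a≤x) (lower x≤b)))
    ... | I , F , cp , ↓b⊆I , ↑a⊆F with everyPrime I F cp
    ... | P , isPrime , (I⊆P , _) , (F⊆∁P , _) =
      P , isPrime , I⊆P (↓b⊆I (lift ≤-refl)) , F⊆∁P (↑a⊆F (lift ≤-refl))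

mainTheorem9 : ∀ {c ℓ : Level} →
    ExcludedMiddle (suc (c ⊔ ℓ)) → Zorn (suc (c ⊔ ℓ)) (c ⊔ ℓ) →
    (L : Lattice c ℓ) →
    let open LatticeNotions L in
    (IsDistributive ⇔ EveryComaximalPairIsPrime)
    × (IsDistributive ⇔ bLIsBijective)
mainTheorem9 em zorn L =
  mk⇔ distributive⇒everyPrime everyPrime⇒distributive ,
  mk⇔ (λ dist → (λ _ → prime⇒comaximalPair L em) , (λ _ _ _ _ → proj₁) , distributive⇒everyPrime dist)
      (everyPrime⇒distributive ∘ proj₂ ∘ proj₂)
  where
  open LatticeNotions L

  distributive⇒everyPrime : IsDistributive → EveryComaximalPairIsPrime
  distributive⇒everyPrime = distributive⇒everyComaximalPairIsPrime L em

  everyPrime⇒distributive : EveryComaximalPairIsPrime → IsDistributive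
  everyPrime⇒distributive =
    primeIdealsSeparate⇒distributive L em ∘ everyComaximalPairIsPrime⇒primeIdealsSeparate L em zorn
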